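{- Let $n\ge 2$. (a) If $n\in\{2,3\}$, then $\dim_{1,f}(P_n)=1$; if $n\in\{4,5\}$, then $\dim_{1,f}(P_n)=\frac{8-n}{7-n}$. (b) If $n\ge 6$, then $\dim_{1,f}(P_n)=\frac{n+1}{4}$ if $n\equiv 1\pmod 4$, and $\dim_{1,f}(P_n)=\lceil\frac n4\rceil$ if $n\equiv 2,3\pmod 4$. (c) If $n\ge 8$ and $n\equiv 0\pmod 4$, then $\frac n4\le\dim_{1,f}(P_n)\le\frac{n+2}{4}$.
   Context: $P_n$ is the path on $n$ vertices. $d(x,y)$ denotes the distance in a graph $G$. Let $d_1(x,y)=\min\{d(x,y),2\}$ and, for distinct $x,y\in V(G)$, $R_1\{x,y\}=\{z\in V(G): d_1(x,z)\neq d_1(y,z)\}$. For $g$ defined on $V(G)$ and $U\subseteq V(G)$, $g(U)=\sum_{s\in U}g(s)$. A function $h:V(G)\to[0,1]$ is a $1$-truncated resolving function if $h(R_1\{x,y\})\ge 1$ for all distinct $x,y$; $\dim_{1,f}(G)$ is the minimum of $h(V(G))$ over such $h$.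
   Formalization: The 1-truncated resolving functions take values in the rational numbers of $[0,1]$ rather than in the whole interval $[0,1]$. -}

module Defs where

open import Data.Nat as ℕ using (ℕ; zero; suc; _⊓_; ∣_-_∣; _∸_)
open import Data.Nat.DivMod using (_/_)
open import Data.Fin as F using (Fin; toℕ)
open import Data.Rational using (ℚ; 0ℚ; 1ℚ; _+_; _≤_)
open import Data.Product using (Σ; _×_)
open import Relation.Binary.PropositionalEquality using (_≡_)
open import Relation.Nullary using (¬_; yes; no)

-- The path P_n: vertex set Fin n (vertices 0,…,n-1), i adjacent to i+1.
-- Its graph distance is d(i,j) = |i - j|.
dist : {n : ℕ} → Fin n → Fin n → ℕ
dist x y = ∣ toℕ x - toℕ y ∣

d₁ : {n : ℕ} → Fin n → Fin n → ℕ
d₁ x y = dist x y ⊓ 2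

Σℚ : (n : ℕ) → (Fin n → ℚ) → ℚ
Σℚ zero    f = 0ℚ
Σℚ (suc n) f = f F.zero + Σℚ n (λ i → f (F.suc i))

-- h restricted to R_1{x,y}: h(z) if d_1(x,z) ≠ d_1(y,z), else 0
inR₁ : {n : ℕ} → (Fin n → ℚ) → Fin n → Fin n → Fin n → ℚ
inR₁ h x y z with d₁ x z ℕ.≟ d₁ y z
... | yes _ = 0ℚ
... | no  _ = h z

hR₁ : {n : ℕ} → (Fin n → ℚ) → Fin n → Fin n → ℚ
hR₁ {n} h x y = Σℚ n (inR₁ h x y)

total : {n : ℕ} → (Fin n → ℚ) → ℚ
total {n} h = Σℚ n h

IsResolving : (n : ℕ) → (Fin n → ℚ) → Set
IsResolving n h =
  ((z : Fin n) → (0ℚ ≤ h z) × (h z ≤ 1ℚ)) ×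
  ((x y : Fin n) → ¬ (x ≡ y) → 1ℚ ≤ hR₁ h x y)

-- dim_{1,f}(P_n) = q : q is attained by some resolving function and is a lower bound
-- for the total weight of every resolving function.
DimIs : (n : ℕ) → ℚ → Set
DimIs n q =
  Σ (Fin n → ℚ) (λ h → IsResolving n h × total h ≡ q) ×
  ((h : Fin n → ℚ) → IsResolving n h → q ≤ total h)

⌈_/4⌉ : ℕ → ℕ
⌈ n /4⌉ = (n ℕ.+ 3) / 4

Weight : ℕ → Set
Weight n = Fin n → ℚ

-- On a path, R₁{a,b} with a < b lies within distance 1 of {a, b}.  Hence
-- the two middle vertices of any four consecutive ones force weight ≥ 1 on those four, an
-- end pair forces weight ≥ 1 on the three end vertices, and, since each of the vertices
-- 0,…,5 lies in exactly two of R₁{0,2}, R₁{0,4}, R₁{2,4}, the first six vertices carry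
-- weight ≥ 3/2.  Tiling P_n by such windows gives the lower bounds; P₄ and P₅ are settled
-- by the same double counting over the whole path.
--
-- Put ½ on every even vertex and on the last one.  For x < y, the marked
-- vertex in {x-1, x} and the one in {y, y+1} (or y itself when y is last) are at distance
-- ≤ 1 from x, resp. y, and strictly farther from the other one, so both lie in R₁{x,y}.
-- The total weight is ½(⌊n/2⌋ + 1).  For P₄ the constant weight 1/3 is optimal.

module Submission where

open import Algebra.Bundles using (CommutativeMonoid)
open import Data.Fin.Base as Fin using (Fin; toℕ; fromℕ<)
import Data.Fin.Properties as Finₚ
open import Data.Integer.Base as ℤ using ()
import Data.Integer.Properties as ℤₚ
open import Data.Integer.Solver using () renaming (module +-*-Solver to ℤ-Solver)
open import Data.List.Base using (List; []; _∷_; length)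
open import Data.List.Relation.Unary.All as All using (All; []; _∷_)
open import Data.Nat.Base as ℕ using (ℕ; zero; suc; z≤n; s≤s; _⊓_; ∣_-_∣; _/_; _%_; ⌊_/2⌋; ⌈_/2⌉)
import Data.Nat.DivMod as ℕ
open import Data.Nat.Divisibility using (divides-refl)
import Data.Nat.Properties as ℕₚ
open import Data.Nat.Solver using () renaming (module +-*-Solver to ℕ-Solver)
open import Data.Product.Base using (Σ; ∃; _×_; _,_; proj₁; proj₂; map₂)
open import Data.Rational.Base as ℚ using (ℚ; 0ℚ; 1ℚ; ½; _+_; _*_; _≤_; toℚᵘ)
import Data.Rational.Properties as ℚₚ
open import Algebra.Properties.CommutativeSemigroup
  (CommutativeMonoid.commutativeSemigroup ℚₚ.+-0-commutativeMonoid)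
  using (interchange; xy∙z≈xz∙y)
import Data.Rational.Unnormalised.Base as ℚᵘ
import Data.Rational.Unnormalised.Properties as ℚᵘₚ
open import Data.Sum.Base using (_⊎_; inj₁; inj₂)
open import Relation.Binary.Definitions using (tri<; tri≈; tri>)
open import Relation.Binary.PropositionalEquality
open import Relation.Nullary.Decidable
  using (Dec; yes; no; True; toWitness; from-yes; from-no; ¬?; _×-dec_; _→-dec_)
open import Relation.Nullary.Negation using (contradiction)
open import Relation.Unary using (Decidable)

open import Defs

⌊r+4k/2⌋≡2k : ∀ r k → r ℕ.< 2 → ⌊ r ℕ.+ k ℕ.* 4 /2⌋ ≡ k ℕ.* 2
⌊r+4k/2⌋≡2k 0             zero    _   = refl
⌊r+4k/2⌋≡2k 0             (suc k) r<2 = cong (λ t → suc (suc t)) (⌊r+4k/2⌋≡2k 0 k r<2)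
⌊r+4k/2⌋≡2k 1             zero    _   = refl
⌊r+4k/2⌋≡2k 1             (suc k) r<2 = cong (λ t → suc (suc t)) (⌊r+4k/2⌋≡2k 1 k r<2)
⌊r+4k/2⌋≡2k (suc (suc _)) _       (s≤s (s≤s ()))

[4m+r]/4≡m : ∀ m r → r ℕ.< 4 → (m ℕ.* 4 ℕ.+ r) / 4 ≡ m
[4m+r]/4≡m m r r<4 = trans (ℕ.+-distrib-/-∣ˡ r (divides-refl m))
  (trans (cong₂ ℕ._+_ (ℕ.m*n/n≡m m 4) (ℕ.m<n⇒m/n≡0 r<4)) (ℕₚ.+-identityʳ m))

mod-4-view : ∀ {n r} → n % 4 ≡ r → n ≡ r ℕ.+ n / 4 ℕ.* 4
mod-4-view {n} refl = ℕ.m≡m%n+[m/n]*n n 4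

fromℕ : ℕ → ℚ
fromℕ zero    = 0ℚ
fromℕ (suc m) = 1ℚ + fromℕ m

fromℕ-+ : ∀ a b → fromℕ (a ℕ.+ b) ≡ fromℕ a + fromℕ b
fromℕ-+ zero    b = sym (ℚₚ.+-identityˡ (fromℕ b))
fromℕ-+ (suc a) b = trans (cong (1ℚ +_) (fromℕ-+ a b)) (sym (ℚₚ.+-assoc 1ℚ (fromℕ a) (fromℕ b)))

fromℕ-* : ∀ a b → fromℕ (a ℕ.* b) ≡ fromℕ a * fromℕ b
fromℕ-* zero    b = sym (ℚₚ.*-zeroˡ (fromℕ b))
fromℕ-* (suc a) b = begin
  fromℕ (b ℕ.+ a ℕ.* b)             ≡⟨ fromℕ-+ b (a ℕ.* b) ⟩
  fromℕ b + fromℕ (a ℕ.* b)         ≡⟨ cong₂ _+_ (sym (ℚₚ.*-identityˡ (fromℕ b))) (fromℕ-* a b) ⟩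
  1ℚ * fromℕ b + fromℕ a * fromℕ b  ≡⟨ ℚₚ.*-distribʳ-+ (fromℕ b) 1ℚ (fromℕ a) ⟨
  (1ℚ + fromℕ a) * fromℕ b          ∎
  where open ≡-Reasoning

fromℕ-nonNeg : ∀ a → 0ℚ ≤ fromℕ a
fromℕ-nonNeg zero    = ℚₚ.≤-refl
fromℕ-nonNeg (suc a) = ℚₚ.+-mono-≤ (ℚₚ.nonNegative⁻¹ 1ℚ) (fromℕ-nonNeg a)

fromℕ-mono-≤ : ∀ {a b} → a ℕ.≤ b → fromℕ a ≤ fromℕ b
fromℕ-mono-≤ {b = b} z≤n = fromℕ-nonNeg b
fromℕ-mono-≤ (s≤s le)    = ℚₚ.+-monoʳ-≤ 1ℚ (fromℕ-mono-≤ le)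

*-nonNeg : ∀ {p q} → 0ℚ ≤ p → 0ℚ ≤ q → 0ℚ ≤ p * q
*-nonNeg {p} {q} p≥0 q≥0 = ℚₚ.nonNegative⁻¹ (p * q)
  {{ℚₚ.nonNeg*nonNeg⇒nonNeg p {{ℚ.nonNegative p≥0}} q {{ℚ.nonNegative q≥0}}}}

fromℕ-suc-positive : ∀ d → ℚ.Positive (fromℕ (suc d))
fromℕ-suc-positive d = ℚ.positive (ℚₚ.+-mono-<-≤ (ℚₚ.positive⁻¹ 1ℚ) (fromℕ-nonNeg d))

-- ℚ's _/_ normalises by a gcd, so identities involving it are checked on ℚᵘ.
toℚᵘ-fromℕ : ∀ a → toℚᵘ (fromℕ a) ℚᵘ.≃ ℚᵘ.mkℚᵘ (ℤ.+ a) 0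
toℚᵘ-fromℕ zero    = ℚᵘ.*≡* refl
toℚᵘ-fromℕ (suc a) = ℚᵘₚ.≃-trans (ℚₚ.toℚᵘ-homo-+ 1ℚ (fromℕ a))
  (ℚᵘₚ.≃-trans (ℚᵘₚ.+-congʳ (toℚᵘ 1ℚ) (toℚᵘ-fromℕ a)) (ℚᵘ.*≡* (cross-multiplied (ℤ.+ a))))
  where
  open ℤ-Solver
  cross-multiplied : ∀ x → (ℤ.+ 1 ℤ.* ℤ.+ 1 ℤ.+ x ℤ.* ℤ.+ 1) ℤ.* ℤ.+ 1 ≡ (ℤ.+ 1 ℤ.+ x) ℤ.* (ℤ.+ 1 ℤ.* ℤ.+ 1)
  cross-multiplied = solve 1 (λ x → (con (ℤ.+ 1) :* con (ℤ.+ 1) :+ x :* con (ℤ.+ 1)) :* con (ℤ.+ 1)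
                                    := (con (ℤ.+ 1) :+ x) :* (con (ℤ.+ 1) :* con (ℤ.+ 1))) refl

[a/d]*d≡a : ∀ a d → (ℤ.+ a ℚ./ suc d) * fromℕ (suc d) ≡ fromℕ a
[a/d]*d≡a a d = ℚₚ.toℚᵘ-injective (ℚᵘₚ.≃-trans (ℚₚ.toℚᵘ-homo-* (ℤ.+ a ℚ./ suc d) (fromℕ (suc d)))
  (ℚᵘₚ.≃-trans (ℚᵘₚ.*-cong (ℚₚ.toℚᵘ-fromℚᵘ (ℚᵘ.mkℚᵘ (ℤ.+ a) d)) (toℚᵘ-fromℕ (suc d)))
  (ℚᵘₚ.≃-trans (ℚᵘ.*≡* (ℤₚ.*-assoc (ℤ.+ a) (ℤ.+ suc d) (ℤ.+ 1))) (ℚᵘₚ.≃-sym (toℚᵘ-fromℕ a)))))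

a≤q*d⇒a/d≤q : ∀ {a d q} → fromℕ a ≤ q * fromℕ (suc d) → ℤ.+ a ℚ./ suc d ≤ q
a≤q*d⇒a/d≤q {a} {d} le = ℚₚ.*-cancelʳ-≤-pos (fromℕ (suc d)) {{fromℕ-suc-positive d}}
  (subst (_≤ _) (sym ([a/d]*d≡a a d)) le)

q*d≤a⇒q≤a/d : ∀ {a d q} → q * fromℕ (suc d) ≤ fromℕ a → q ≤ ℤ.+ a ℚ./ suc d
q*d≤a⇒q≤a/d {a} {d} le = ℚₚ.*-cancelʳ-≤-pos (fromℕ (suc d)) {{fromℕ-suc-positive d}}
  (subst (_ ≤_) (sym ([a/d]*d≡a a d)) le)

a≡q*d⇒a/d≡q : ∀ {a d q} → fromℕ a ≡ q * fromℕ (suc d) → ℤ.+ a ℚ./ suc d ≡ q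
a≡q*d⇒a/d≡q {a} {d} e =
  ℚₚ.≤-antisym (a≤q*d⇒a/d≤q {a} {d} (ℚₚ.≤-reflexive e)) (q*d≤a⇒q≤a/d {a} {d} (ℚₚ.≤-reflexive (sym e)))

½*[2a]≡a : ∀ a → ½ * fromℕ (a ℕ.* 2) ≡ fromℕ a
½*[2a]≡a a = begin
  ½ * fromℕ (a ℕ.* 2)       ≡⟨ cong (½ *_) (trans (fromℕ-* a 2) (ℚₚ.*-comm (fromℕ a) (fromℕ 2))) ⟩
  ½ * (fromℕ 2 * fromℕ a)   ≡⟨ ℚₚ.*-assoc ½ (fromℕ 2) (fromℕ a) ⟨
  1ℚ * fromℕ a              ≡⟨ ℚₚ.*-identityˡ (fromℕ a) ⟩
  fromℕ a                   ∎
  where open ≡-Reasoning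

½*[c+2k]≡½*c+k : ∀ c k → ½ * fromℕ (c ℕ.+ k ℕ.* 2) ≡ ½ * fromℕ c + fromℕ k
½*[c+2k]≡½*c+k c k = trans (cong (½ *_) (fromℕ-+ c (k ℕ.* 2)))
  (trans (ℚₚ.*-distribˡ-+ ½ (fromℕ c) (fromℕ (k ℕ.* 2))) (cong (½ * fromℕ c +_) (½*[2a]≡a k)))

2a≡bd⇒a/d≡½b : ∀ {a d} b → a ℕ.* 2 ≡ b ℕ.* suc d → ℤ.+ a ℚ./ suc d ≡ ½ * fromℕ b
2a≡bd⇒a/d≡½b {a} {d} b a*2≡b*d = a≡q*d⇒a/d≡q {a} {d} (begin
  fromℕ a                          ≡⟨ ½*[2a]≡a a ⟨
  ½ * fromℕ (a ℕ.* 2)              ≡⟨ cong (λ m → ½ * fromℕ m) a*2≡b*d ⟩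
  ½ * fromℕ (b ℕ.* suc d)          ≡⟨ cong (½ *_) (fromℕ-* b (suc d)) ⟩
  ½ * (fromℕ b * fromℕ (suc d))    ≡⟨ ℚₚ.*-assoc ½ (fromℕ b) (fromℕ (suc d)) ⟨
  ½ * fromℕ b * fromℕ (suc d)      ∎)
  where open ≡-Reasoning

∑ : ℕ → (ℕ → ℚ) → ℚ
∑ zero    f = 0ℚ
∑ (suc n) f = f 0 + ∑ n (λ i → f (suc i))

Σℚ≡∑ : ∀ n (h : Fin n → ℚ) (g : ℕ → ℚ) → (∀ z → h z ≡ g (toℕ z)) → Σℚ n h ≡ ∑ n g
Σℚ≡∑ zero    h g h≗g = refl
Σℚ≡∑ (suc n) h g h≗g =
  cong₂ _+_ (h≗g Fin.zero) (Σℚ≡∑ n (λ z → h (Fin.suc z)) (λ i → g (suc i)) (λ z → h≗g (Fin.suc z)))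

∑-cong : ∀ {f g} n → (∀ i → i ℕ.< n → f i ≡ g i) → ∑ n f ≡ ∑ n g
∑-cong zero    f≗g = refl
∑-cong (suc n) f≗g = cong₂ _+_ (f≗g 0 (s≤s z≤n)) (∑-cong n (λ i i<n → f≗g (suc i) (s≤s i<n)))

∑-zero : ∀ {f} n → (∀ i → i ℕ.< n → f i ≡ 0ℚ) → ∑ n f ≡ 0ℚ
∑-zero zero    f≗0 = refl
∑-zero (suc n) f≗0 = cong₂ _+_ (f≗0 0 (s≤s z≤n)) (∑-zero n (λ i i<n → f≗0 (suc i) (s≤s i<n)))

∑-mono-≤ : ∀ {f g} n → (∀ i → i ℕ.< n → f i ≤ g i) → ∑ n f ≤ ∑ n g
∑-mono-≤ zero    f≤g = ℚₚ.≤-refl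
∑-mono-≤ (suc n) f≤g = ℚₚ.+-mono-≤ (f≤g 0 (s≤s z≤n)) (∑-mono-≤ n (λ i i<n → f≤g (suc i) (s≤s i<n)))

∑-nonNeg : ∀ {f} n → (∀ i → 0ℚ ≤ f i) → 0ℚ ≤ ∑ n f
∑-nonNeg n f≥0 = subst (_≤ ∑ n _) (∑-zero n (λ _ _ → refl)) (∑-mono-≤ n (λ i _ → f≥0 i))

∑-+ : ∀ a b f → ∑ (a ℕ.+ b) f ≡ ∑ a f + ∑ b (λ i → f (a ℕ.+ i))
∑-+ zero    b f = sym (ℚₚ.+-identityˡ _)
∑-+ (suc a) b f = trans (cong (f 0 +_) (∑-+ a b (λ i → f (suc i)))) (sym (ℚₚ.+-assoc (f 0) _ _))

∑-snoc : ∀ n f → ∑ (suc n) f ≡ ∑ n f + f n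
∑-snoc zero    f = ℚₚ.+-comm (f 0) 0ℚ
∑-snoc (suc n) f = trans (cong (f 0 +_) (∑-snoc n (λ i → f (suc i)))) (sym (ℚₚ.+-assoc (f 0) _ _))

∑-distrib-+ : ∀ f g n → ∑ n (λ i → f i + g i) ≡ ∑ n f + ∑ n g
∑-distrib-+ f g zero    = refl
∑-distrib-+ f g (suc n) = trans (cong (f 0 + g 0 +_) (∑-distrib-+ (λ i → f (suc i)) (λ i → g (suc i)) n))
  (interchange (f 0) (g 0) _ _)

∑-*ʳ : ∀ f q n → ∑ n (λ i → f i * q) ≡ ∑ n f * q
∑-*ʳ f q zero    = sym (ℚₚ.*-zeroˡ q)
∑-*ʳ f q (suc n) = trans (cong (f 0 * q +_) (∑-*ʳ (λ i → f (suc i)) q n))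
  (sym (ℚₚ.*-distribʳ-+ q (f 0) (∑ n (λ i → f (suc i)))))

∑-≥-term : ∀ {f} n p → (∀ i → 0ℚ ≤ f i) → p ℕ.< n → f p ≤ ∑ n f
∑-≥-term {f} (suc n) zero    f≥0 _ = subst (_≤ ∑ (suc n) f) (ℚₚ.+-identityʳ (f 0))
  (ℚₚ.+-monoʳ-≤ (f 0) (∑-nonNeg n (λ i → f≥0 (suc i))))
∑-≥-term {f} (suc n) (suc p) f≥0 (s≤s p<n) = subst (_≤ _) (ℚₚ.+-identityˡ (f (suc p)))
  (ℚₚ.+-mono-≤ (f≥0 0) (∑-≥-term n p (λ i → f≥0 (suc i)) p<n))

∑-≥-two-terms : ∀ {f} n p q → (∀ i → 0ℚ ≤ f i) → p ℕ.< q → q ℕ.< n → f p + f q ≤ ∑ n f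
∑-≥-two-terms {f} (suc n) zero    (suc q) f≥0 _ (s≤s q<n) =
  ℚₚ.+-monoʳ-≤ (f 0) (∑-≥-term n q (λ i → f≥0 (suc i)) q<n)
∑-≥-two-terms {f} (suc n) (suc p) (suc q) f≥0 (s≤s p<q) (s≤s q<n) =
  subst (_≤ _) (ℚₚ.+-identityˡ (f (suc p) + f (suc q)))
  (ℚₚ.+-mono-≤ (f≥0 0) (∑-≥-two-terms n p q (λ i → f≥0 (suc i)) p<q q<n))

∑-≤-window : ∀ {f g} n c len → c ℕ.+ len ℕ.≤ n →
  (∀ i → i ℕ.< c → f i ≡ 0ℚ) →
  (∀ i → i ℕ.< len → f (c ℕ.+ i) ≤ g i) →
  (∀ i → c ℕ.+ len ℕ.≤ i → i ℕ.< n → f i ≡ 0ℚ) →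
  ∑ n f ≤ ∑ len g
∑-≤-window {f} {g} n c len c+len≤n before inside after with ℕₚ.m≤n⇒∃[o]m+o≡n c+len≤n
... | o , refl = begin
  ∑ (c ℕ.+ len ℕ.+ o) f                                 ≡⟨ ∑-+ (c ℕ.+ len) o f ⟩
  ∑ (c ℕ.+ len) f + ∑ o (λ i → f (c ℕ.+ len ℕ.+ i))     ≡⟨ cong (∑ (c ℕ.+ len) f +_) (∑-zero o vanish) ⟩
  ∑ (c ℕ.+ len) f + 0ℚ                                  ≡⟨ ℚₚ.+-identityʳ _ ⟩
  ∑ (c ℕ.+ len) f                                       ≡⟨ ∑-+ c len f ⟩
  ∑ c f + ∑ len (λ i → f (c ℕ.+ i))                     ≡⟨ cong (_+ ∑ len (λ i → f (c ℕ.+ i))) (∑-zero c before) ⟩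
  0ℚ + ∑ len (λ i → f (c ℕ.+ i))                        ≡⟨ ℚₚ.+-identityˡ _ ⟩
  ∑ len (λ i → f (c ℕ.+ i))                             ≤⟨ ∑-mono-≤ len inside ⟩
  ∑ len g                                               ∎
  where
  open ℚₚ.≤-Reasoning
  vanish : ∀ i → i ℕ.< o → f (c ℕ.+ len ℕ.+ i) ≡ 0ℚ
  vanish i i<o = after _ (ℕₚ.m≤m+n _ i) (ℕₚ.+-monoʳ-< (c ℕ.+ len) i<o)

-- P_n is an interval of the infinite path ℕ, so R₁ is computed there: χR₁ a b is the
-- indicator function of R₁{a,b}, and weights are extended by zero beyond the last vertex.
d₁ℕ : ℕ → ℕ → ℕ
d₁ℕ a i = ∣ a - i ∣ ⊓ 2

χR₁ : ℕ → ℕ → ℕ → ℕ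
χR₁ a b i with d₁ℕ a i ℕₚ.≟ d₁ℕ b i
... | yes _ = 0
... | no  _ = 1

χR₁≤1 : ∀ a b i → χR₁ a b i ℕ.≤ 1
χR₁≤1 a b i with d₁ℕ a i ℕₚ.≟ d₁ℕ b i
... | yes _ = z≤n
... | no  _ = ℕₚ.≤-refl

χR₁-comm : ∀ a b i → χR₁ a b i ≡ χR₁ b a i
χR₁-comm a b i with d₁ℕ a i ℕₚ.≟ d₁ℕ b i | d₁ℕ b i ℕₚ.≟ d₁ℕ a i
... | yes _  | yes _  = refl
... | no  _  | no  _  = refl
... | yes ab | no  ba = contradiction (sym ab) ba
... | no  ab | yes ba = contradiction (sym ba) ab

χR₁-≡0 : ∀ {a b i} → d₁ℕ a i ≡ d₁ℕ b i → χR₁ a b i ≡ 0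
χR₁-≡0 {a} {b} {i} eq with d₁ℕ a i ℕₚ.≟ d₁ℕ b i
... | yes _  = refl
... | no  ne = contradiction eq ne

χR₁-≡1 : ∀ {a b i} → d₁ℕ a i ≢ d₁ℕ b i → χR₁ a b i ≡ 1
χR₁-≡1 {a} {b} {i} ne with d₁ℕ a i ℕₚ.≟ d₁ℕ b i
... | yes eq = contradiction eq ne
... | no  _  = refl

χR₁-far : ∀ {a b i} → 2 ℕ.≤ ∣ a - i ∣ → 2 ℕ.≤ ∣ b - i ∣ → χR₁ a b i ≡ 0
χR₁-far a-far b-far = χR₁-≡0 (trans (ℕₚ.m≥n⇒m⊓n≡n a-far) (sym (ℕₚ.m≥n⇒m⊓n≡n b-far)))

χR₁-near : ∀ {a b i} → ∣ a - i ∣ ℕ.< ∣ b - i ∣ → ∣ a - i ∣ ℕ.< 2 → χR₁ a b i ≡ 1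
χR₁-near {a} {b} {i} closer near = χR₁-≡1 (ℕₚ.<⇒≢
  (subst (ℕ._< d₁ℕ b i) (sym (ℕₚ.m≤n⇒m⊓n≡m (ℕₚ.<⇒≤ near))) (ℕₚ.⊓-glb closer near)))

2≤∣-∣ˡ : ∀ {a i} → 2 ℕ.+ i ℕ.≤ a → 2 ℕ.≤ ∣ a - i ∣
2≤∣-∣ˡ {a} {i} 2+i≤a = subst (2 ℕ.≤_) (sym (ℕₚ.m≤n⇒∣n-m∣≡n∸m (ℕₚ.≤-trans (ℕₚ.m≤n+m i 2) 2+i≤a)))
  (ℕₚ.m+n≤o⇒m≤o∸n 2 2+i≤a)

2≤∣-∣ʳ : ∀ {a i} → 2 ℕ.+ a ℕ.≤ i → 2 ℕ.≤ ∣ a - i ∣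
2≤∣-∣ʳ {a} {i} 2+a≤i = subst (2 ℕ.≤_) (ℕₚ.∣-∣-comm i a) (2≤∣-∣ˡ 2+a≤i)

χR₁-before : ∀ {a b i} → a ℕ.≤ b → 2 ℕ.+ i ℕ.≤ a → χR₁ a b i ≡ 0
χR₁-before a≤b 2+i≤a = χR₁-far (2≤∣-∣ˡ 2+i≤a) (2≤∣-∣ˡ (ℕₚ.≤-trans 2+i≤a a≤b))

χR₁-beyond : ∀ {a b i} → a ℕ.≤ b → 2 ℕ.+ b ℕ.≤ i → χR₁ a b i ≡ 0
χR₁-beyond a≤b 2+b≤i = χR₁-far (2≤∣-∣ʳ (ℕₚ.≤-trans (ℕₚ.+-monoʳ-≤ 2 a≤b) 2+b≤i)) (2≤∣-∣ʳ 2+b≤i)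

χR₁-adjacent-before : ∀ c i → i ℕ.< c → χR₁ (1 ℕ.+ c) (2 ℕ.+ c) i ≡ 0
χR₁-adjacent-before c i i<c = χR₁-before (ℕₚ.n≤1+n (1 ℕ.+ c)) (s≤s i<c)

χR₁-left-neighbour : ∀ {a b p} → p ℕ.≤ a → a ℕ.≤ p ℕ.+ 1 → a ℕ.< b → χR₁ a b p ≡ 1
χR₁-left-neighbour {a} {b} {p} p≤a a≤p+1 a<b = χR₁-near
  (subst₂ ℕ._<_ (sym (ℕₚ.m≤n⇒∣n-m∣≡n∸m p≤a)) (sym (ℕₚ.m≤n⇒∣n-m∣≡n∸m p≤b)) (ℕₚ.∸-monoˡ-< a<b p≤a))
  (subst (ℕ._< 2) (sym (ℕₚ.m≤n⇒∣n-m∣≡n∸m p≤a)) (s≤s (ℕₚ.m≤n+o⇒m∸n≤o a p a≤p+1)))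
  where
  p≤b : p ℕ.≤ b
  p≤b = ℕₚ.≤-trans p≤a (ℕₚ.<⇒≤ a<b)

χR₁-right-neighbour : ∀ {a b q} → b ℕ.≤ q → q ℕ.≤ b ℕ.+ 1 → a ℕ.< b → χR₁ a b q ≡ 1
χR₁-right-neighbour {a} {b} {q} b≤q q≤b+1 a<b = trans (χR₁-comm a b q) (χR₁-near
  (subst₂ ℕ._<_ (sym (ℕₚ.m≤n⇒∣m-n∣≡n∸m b≤q)) (sym (ℕₚ.m≤n⇒∣m-n∣≡n∸m a≤q)) (ℕₚ.∸-monoʳ-< a<b b≤q))
  (subst (ℕ._< 2) (sym (ℕₚ.m≤n⇒∣m-n∣≡n∸m b≤q)) (s≤s (ℕₚ.m≤n+o⇒m∸n≤o q b q≤b+1))))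
  where
  a≤q : a ℕ.≤ q
  a≤q = ℕₚ.≤-trans (ℕₚ.<⇒≤ a<b) b≤q

inR₁≡*χR₁ : ∀ {n} (h : Weight n) x y z → inR₁ h x y z ≡ h z * fromℕ (χR₁ (toℕ x) (toℕ y) (toℕ z))
inR₁≡*χR₁ h x y z with d₁ x z ℕₚ.≟ d₁ y z
... | yes _ = sym (ℚₚ.*-zeroʳ (h z))
... | no  _ = sym (ℚₚ.*-identityʳ (h z))

hR₁≡∑ : ∀ {n} (h : Weight n) (g : ℕ → ℚ) → (∀ z → h z ≡ g (toℕ z)) →
  ∀ x y → hR₁ h x y ≡ ∑ n (λ i → g i * fromℕ (χR₁ (toℕ x) (toℕ y) i))
hR₁≡∑ {n} h g h≗g x y = Σℚ≡∑ n (inR₁ h x y) _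
  (λ z → trans (inR₁≡*χR₁ h x y z) (cong (_* fromℕ (χR₁ (toℕ x) (toℕ y) (toℕ z))) (h≗g z)))

isResolving? : ∀ n (h : Weight n) → Dec (IsResolving n h)
isResolving? n h = Finₚ.all? (λ z → 0ℚ ℚₚ.≤? h z ×-dec h z ℚₚ.≤? 1ℚ)
  ×-dec Finₚ.all? (λ x → Finₚ.all? (λ y → ¬? (x Finₚ.≟ y) →-dec 1ℚ ℚₚ.≤? hR₁ h x y))

zeroExtend : ∀ {n} → Weight n → ℕ → ℚ
zeroExtend {n} h i with i ℕₚ.<? n
... | yes i<n = h (fromℕ< i<n)
... | no  _   = 0ℚ

zeroExtend-toℕ : ∀ {n} (h : Weight n) z → h z ≡ zeroExtend h (toℕ z)
zeroExtend-toℕ {n} h z with toℕ z ℕₚ.<? n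
... | yes z<n = cong h (sym (Finₚ.fromℕ<-toℕ z z<n))
... | no  z≮n = contradiction (Finₚ.toℕ<n z) z≮n

zeroExtend-nonNeg : ∀ {n} (h : Weight n) → (∀ z → 0ℚ ≤ h z) → ∀ i → 0ℚ ≤ zeroExtend h i
zeroExtend-nonNeg {n} h h≥0 i with i ℕₚ.<? n
... | yes _ = h≥0 _
... | no  _ = ℚₚ.≤-refl

multiplicity : List (ℕ × ℕ) → ℕ → ℕ
multiplicity []             i = 0
multiplicity ((a , b) ∷ ps) i = χR₁ a b i ℕ.+ multiplicity ps i

ValidPair : ℕ → ℕ × ℕ → Set
ValidPair n (a , b) = a ℕ.< b × b ℕ.< n

validPair? : ∀ n → Decidable (ValidPair n)
validPair? n (a , b) = a ℕₚ.<? b ×-dec b ℕₚ.<? n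

ValidPair-mono : ∀ {m n} → m ℕ.≤ n → ∀ {p} → ValidPair m p → ValidPair n p
ValidPair-mono m≤n (a<b , b<m) = a<b , ℕₚ.<-≤-trans b<m m≤n

pairs-0-2-4 : List (ℕ × ℕ)
pairs-0-2-4 = (0 , 2) ∷ (0 , 4) ∷ (2 , 4) ∷ []

module LowerBound {n : ℕ} (h : Weight n) (h-resolving : IsResolving n h) where

  g : ℕ → ℚ
  g = zeroExtend h

  g-nonNeg : ∀ i → 0ℚ ≤ g i
  g-nonNeg = zeroExtend-nonNeg h (λ z → proj₁ (proj₁ h-resolving z))

  window : ℕ → ℕ → ℚ
  window c len = ∑ len (λ i → g (c ℕ.+ i))

  total≡window : total h ≡ window 0 n
  total≡window = Σℚ≡∑ n h g (zeroExtend-toℕ h)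

  pair-resolved : ∀ {a b} → ValidPair n (a , b) → 1ℚ ≤ ∑ n (λ i → g i * fromℕ (χR₁ a b i))
  pair-resolved {a} {b} (a<b , b<n) = subst (1ℚ ≤_)
    (trans (hR₁≡∑ h g (zeroExtend-toℕ h) x y)
           (cong₂ (λ u v → ∑ n (λ i → g i * fromℕ (χR₁ u v i))) (Finₚ.toℕ-fromℕ< a<n) (Finₚ.toℕ-fromℕ< b<n)))
    (proj₂ h-resolving x y x≢y)
    where
    a<n : a ℕ.< n
    a<n = ℕₚ.<-trans a<b b<n
    x y : Fin n
    x = fromℕ< a<n
    y = fromℕ< b<n
    x≢y : x ≢ y
    x≢y x≡y = ℕₚ.<⇒≢ a<b (trans (sym (Finₚ.toℕ-fromℕ< a<n)) (trans (cong toℕ x≡y) (Finₚ.toℕ-fromℕ< b<n)))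

  pairs-resolved : ∀ ps → All (ValidPair n) ps → fromℕ (length ps) ≤ ∑ n (λ i → g i * fromℕ (multiplicity ps i))
  pairs-resolved []             []             = ℚₚ.≤-reflexive (sym (∑-zero n (λ i _ → ℚₚ.*-zeroʳ (g i))))
  pairs-resolved ((a , b) ∷ ps) (valid ∷ valids) = begin
    1ℚ + fromℕ (length ps)
      ≤⟨ ℚₚ.+-mono-≤ (pair-resolved valid) (pairs-resolved ps valids) ⟩
    ∑ n (λ i → g i * fromℕ (χR₁ a b i)) + ∑ n (λ i → g i * fromℕ (multiplicity ps i))
      ≡⟨ ∑-distrib-+ _ _ n ⟨
    ∑ n (λ i → g i * fromℕ (χR₁ a b i) + g i * fromℕ (multiplicity ps i))
      ≡⟨ ∑-cong n (λ i _ → sym (trans (cong (g i *_) (fromℕ-+ (χR₁ a b i) _)) (ℚₚ.*-distribˡ-+ (g i) _ _))) ⟩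
    ∑ n (λ i → g i * fromℕ (multiplicity ((a , b) ∷ ps) i)) ∎
    where open ℚₚ.≤-Reasoning

  double-counting : ∀ ps m c len → All (ValidPair n) ps → c ℕ.+ len ℕ.≤ n →
    (∀ i → i ℕ.< c → multiplicity ps i ≡ 0) →
    (∀ i → i ℕ.< len → multiplicity ps (c ℕ.+ i) ℕ.≤ m) →
    (∀ i → c ℕ.+ len ℕ.≤ i → i ℕ.< n → multiplicity ps i ≡ 0) →
    fromℕ (length ps) ≤ window c len * fromℕ m
  double-counting ps m c len valid c+len≤n before inside after = begin
    fromℕ (length ps)                                ≤⟨ pairs-resolved ps valid ⟩
    ∑ n (λ i → g i * fromℕ (multiplicity ps i))      ≤⟨ ∑-≤-window n c len c+len≤n
                                                          (λ i i<c → vanish (before i i<c))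
                                                          (λ i i<len → bounded (inside i i<len))
                                                          (λ i c+len≤i i<n → vanish (after i c+len≤i i<n)) ⟩
    ∑ len (λ i → g (c ℕ.+ i) * fromℕ m)             ≡⟨ ∑-*ʳ (λ i → g (c ℕ.+ i)) (fromℕ m) len ⟩
    window c len * fromℕ m                           ∎
    where
    open ℚₚ.≤-Reasoning
    vanish : ∀ {i} → multiplicity ps i ≡ 0 → g i * fromℕ (multiplicity ps i) ≡ 0ℚ
    vanish {i} eq = trans (cong (λ k → g i * fromℕ k) eq) (ℚₚ.*-zeroʳ (g i))
    bounded : ∀ {i} → multiplicity ps i ℕ.≤ m → g i * fromℕ (multiplicity ps i) ≤ g i * fromℕ m
    bounded {i} le = ℚₚ.*-monoˡ-≤-nonNeg (g i) {{ℚ.nonNegative (g-nonNeg i)}} (fromℕ-mono-≤ le)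

  pair-window-≥1 : ∀ {a b} c len → ValidPair n (a , b) → c ℕ.+ len ℕ.≤ n →
    (∀ i → i ℕ.< c → χR₁ a b i ≡ 0) →
    (∀ i → c ℕ.+ len ℕ.≤ i → i ℕ.< n → χR₁ a b i ≡ 0) →
    1ℚ ≤ window c len
  pair-window-≥1 {a} {b} c len valid c+len≤n before after = subst (1ℚ ≤_) (ℚₚ.*-identityʳ (window c len))
    (double-counting ((a , b) ∷ []) 1 c len (valid ∷ []) c+len≤n
      (λ i i<c → cong (ℕ._+ 0) (before i i<c))
      (λ i _ → subst (ℕ._≤ 1) (sym (ℕₚ.+-identityʳ _)) (χR₁≤1 a b _))
      (λ i c+len≤i i<n → cong (ℕ._+ 0) (after i c+len≤i i<n)))

  double-counting-whole-path : ∀ ps m →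
    {True (All.all? (validPair? n) ps)} →
    {True (ℕₚ.allUpTo? (λ i → multiplicity ps i ℕₚ.≤? m) n)} →
    fromℕ (length ps) ≤ total h * fromℕ m
  double-counting-whole-path ps m {valid} {bounded} =
    subst (λ t → fromℕ (length ps) ≤ t * fromℕ m) (sym total≡window)
    (double-counting ps m 0 n (toWitness valid) ℕₚ.≤-refl (λ _ ()) (λ i i<n → toWitness bounded i<n)
      (λ i n≤i i<n → contradiction n≤i (ℕₚ.<⇒≱ i<n)))

  total-≥1 : 2 ℕ.≤ n → 1ℚ ≤ total h
  total-≥1 2≤n = subst (1ℚ ≤_) (sym total≡window)
    (pair-window-≥1 {0} {1} 0 n (ℕₚ.≤-refl , 2≤n) ℕₚ.≤-refl (λ _ ())
      (λ i n≤i i<n → contradiction n≤i (ℕₚ.<⇒≱ i<n)))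

  initial-3-≥1 : 3 ℕ.≤ n → 1ℚ ≤ window 0 3
  initial-3-≥1 3≤n = pair-window-≥1 {0} {1} 0 3 (ℕₚ.≤-refl , ℕₚ.≤-trans (ℕₚ.n≤1+n 2) 3≤n) 3≤n
    (λ _ ()) (λ i 3≤i _ → χR₁-beyond z≤n 3≤i)

  block-≥1 : ∀ c → c ℕ.+ 4 ℕ.≤ n → 1ℚ ≤ window c 4
  block-≥1 c c+4≤n = pair-window-≥1 c 4 (ℕₚ.≤-refl , ℕₚ.<-≤-trans 2+c<c+4 c+4≤n) c+4≤n
    (χR₁-adjacent-before c) (λ i c+4≤i _ → χR₁-beyond (ℕₚ.n≤1+n (1 ℕ.+ c)) (ℕₚ.≤-trans 4+c≤c+4 c+4≤i))
    where
    4+c≤c+4 : 4 ℕ.+ c ℕ.≤ c ℕ.+ 4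
    4+c≤c+4 = ℕₚ.≤-reflexive (ℕₚ.+-comm 4 c)
    2+c<c+4 : 2 ℕ.+ c ℕ.< c ℕ.+ 4
    2+c<c+4 = ℕₚ.<-≤-trans (s≤s (ℕₚ.n≤1+n (2 ℕ.+ c))) 4+c≤c+4

  final-3-≥1 : ∀ c → c ℕ.+ 3 ≡ n → 1ℚ ≤ window c 3
  final-3-≥1 c c+3≡n =
    pair-window-≥1 c 3 (ℕₚ.≤-refl , subst (2 ℕ.+ c ℕ.<_) c+3≡n (ℕₚ.≤-reflexive (ℕₚ.+-comm 3 c))) (ℕₚ.≤-reflexive c+3≡n) (χR₁-adjacent-before c)
    (λ i c+3≤i i<n → contradiction (subst (ℕ._≤ i) c+3≡n c+3≤i) (ℕₚ.<⇒≱ i<n))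

  initial-6-≥3/2 : 6 ℕ.≤ n → ℤ.+ 3 ℚ./ 2 ≤ window 0 6
  initial-6-≥3/2 6≤n = a≤q*d⇒a/d≤q {3} {1}
    (double-counting pairs-0-2-4 2 0 6 valid 6≤n (λ _ ()) at-most-two beyond)
    where
    valid : All (ValidPair n) pairs-0-2-4
    valid = All.map (ValidPair-mono 6≤n) (from-yes (All.all? (validPair? 6) pairs-0-2-4))
    at-most-two : ∀ i → i ℕ.< 6 → multiplicity pairs-0-2-4 i ℕ.≤ 2
    at-most-two i i<6 = from-yes (ℕₚ.allUpTo? (λ i → multiplicity pairs-0-2-4 i ℕₚ.≤? 2) 6) i<6
    beyond : ∀ i → 6 ℕ.≤ i → i ℕ.< n → multiplicity pairs-0-2-4 i ≡ 0
    beyond i 6≤i _ = cong₂ ℕ._+_ (χR₁-beyond z≤n (ℕₚ.≤-trans (ℕₚ.m≤m+n 4 2) 6≤i))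
                    (cong₂ ℕ._+_ (χR₁-beyond z≤n 6≤i) (cong (ℕ._+ 0) (χR₁-beyond (ℕₚ.m≤m+n 2 2) 6≤i)))

  window-split : ∀ c a b → window c (a ℕ.+ b) ≡ window c a + window (c ℕ.+ a) b
  window-split c a b = trans (∑-+ a b (λ i → g (c ℕ.+ i)))
    (cong (window c a +_) (∑-cong b (λ i _ → cong g (sym (ℕₚ.+-assoc c a i)))))

  blocks-≥k : ∀ c k → c ℕ.+ k ℕ.* 4 ℕ.≤ n → fromℕ k ≤ window c (k ℕ.* 4)
  blocks-≥k c zero    _       = ℚₚ.≤-refl
  blocks-≥k c (suc k) c+4k≤n = subst (fromℕ (suc k) ≤_) (sym (window-split c 4 (k ℕ.* 4)))
    (ℚₚ.+-mono-≤ (block-≥1 c (ℕₚ.≤-trans (ℕₚ.+-monoʳ-≤ c (ℕₚ.m≤m+n 4 (k ℕ.* 4))) c+4k≤n))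
                 (blocks-≥k (c ℕ.+ 4) k (ℕₚ.≤-trans (ℕₚ.≤-reflexive (ℕₚ.+-assoc c 4 (k ℕ.* 4))) c+4k≤n)))

  tiling : ∀ a k b {L R} → n ≡ a ℕ.+ k ℕ.* 4 ℕ.+ b →
    L ≤ window 0 a → R ≤ window (a ℕ.+ k ℕ.* 4) b → L + R + fromℕ k ≤ total h
  tiling a k b {L} {R} n≡ L≤ R≤ = begin
    L + R + fromℕ k
      ≡⟨ xy∙z≈xz∙y L R (fromℕ k) ⟩
    L + fromℕ k + R
      ≤⟨ ℚₚ.+-mono-≤ (ℚₚ.+-mono-≤ L≤ (blocks-≥k a k a+4k≤n)) R≤ ⟩
    window 0 a + window a (k ℕ.* 4) + window (a ℕ.+ k ℕ.* 4) b
      ≡⟨ cong (_+ window (a ℕ.+ k ℕ.* 4) b) (window-split 0 a (k ℕ.* 4)) ⟨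
    window 0 (a ℕ.+ k ℕ.* 4) + window (a ℕ.+ k ℕ.* 4) b
      ≡⟨ window-split 0 (a ℕ.+ k ℕ.* 4) b ⟨
    window 0 (a ℕ.+ k ℕ.* 4 ℕ.+ b)
      ≡⟨ cong (window 0) n≡ ⟨
    window 0 n
      ≡⟨ total≡window ⟨
    total h
      ∎
    where
    open ℚₚ.≤-Reasoning
    a+4k≤n : a ℕ.+ k ℕ.* 4 ℕ.≤ n
    a+4k≤n = ℕₚ.≤-trans (ℕₚ.m≤m+n (a ℕ.+ k ℕ.* 4) b) (ℕₚ.≤-reflexive (sym n≡))

evenHalf : ℕ → ℚ
evenHalf zero          = ½
evenHalf (suc zero)    = 0ℚ
evenHalf (suc (suc i)) = evenHalf i

evenHalf-∈[0,1] : ∀ i → 0ℚ ≤ evenHalf i × evenHalf i ≤ 1ℚ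
evenHalf-∈[0,1] zero          = from-yes (0ℚ ℚₚ.≤? ½ ×-dec ½ ℚₚ.≤? 1ℚ)
evenHalf-∈[0,1] (suc zero)    = from-yes (0ℚ ℚₚ.≤? 0ℚ ×-dec 0ℚ ℚₚ.≤? 1ℚ)
evenHalf-∈[0,1] (suc (suc i)) = evenHalf-∈[0,1] i

even-below : ∀ a → ∃ λ p → p ℕ.≤ a × a ℕ.≤ p ℕ.+ 1 × evenHalf p ≡ ½
even-below zero          = 0 , z≤n , z≤n , refl
even-below (suc zero)    = 0 , z≤n , s≤s z≤n , refl
even-below (suc (suc a)) with even-below a
... | p , p≤a , a≤p+1 , even = suc (suc p) , s≤s (s≤s p≤a) , s≤s (s≤s a≤p+1) , even

even-above : ∀ b → ∃ λ q → b ℕ.≤ q × q ℕ.≤ b ℕ.+ 1 × evenHalf q ≡ ½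
even-above zero          = 0 , z≤n , z≤n , refl
even-above (suc zero)    = 2 , s≤s z≤n , ℕₚ.≤-refl , refl
even-above (suc (suc b)) with even-above b
... | q , b≤q , q≤b+1 , even = suc (suc q) , s≤s (s≤s b≤q) , s≤s (s≤s q≤b+1) , even

halfOnEvensAndLastℕ : ℕ → ℕ → ℚ
halfOnEvensAndLastℕ n i with suc i ℕₚ.≟ n
... | yes _ = ½
... | no  _ = evenHalf i

halfOnEvensAndLast : (n : ℕ) → Weight n
halfOnEvensAndLast n z = halfOnEvensAndLastℕ n (toℕ z)

halfOnEvensAndLast-last : ∀ {n i} → suc i ≡ n → halfOnEvensAndLastℕ n i ≡ ½
halfOnEvensAndLast-last {n} {i} last with suc i ℕₚ.≟ n
... | yes _   = refl
... | no  ¬last = contradiction last ¬last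

halfOnEvensAndLast-inner : ∀ {n i} → suc i ≢ n → halfOnEvensAndLastℕ n i ≡ evenHalf i
halfOnEvensAndLast-inner {n} {i} ¬last with suc i ℕₚ.≟ n
... | yes last = contradiction last ¬last
... | no  _    = refl

halfOnEvensAndLast-even : ∀ {n i} → evenHalf i ≡ ½ → halfOnEvensAndLastℕ n i ≡ ½
halfOnEvensAndLast-even {n} {i} even with suc i ℕₚ.≟ n
... | yes _ = refl
... | no  _ = even

halfOnEvensAndLast-∈[0,1] : ∀ n i → 0ℚ ≤ halfOnEvensAndLastℕ n i × halfOnEvensAndLastℕ n i ≤ 1ℚ
halfOnEvensAndLast-∈[0,1] n i with suc i ℕₚ.≟ n
... | yes _ = evenHalf-∈[0,1] 0
... | no  _ = evenHalf-∈[0,1] i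

marked-above : ∀ {n b} → b ℕ.< n → ∃ λ q → b ℕ.≤ q × q ℕ.≤ b ℕ.+ 1 × q ℕ.< n × halfOnEvensAndLastℕ n q ≡ ½
marked-above {n} {b} b<n with even-above b
... | q , b≤q , q≤b+1 , even with q ℕₚ.<? n
...   | yes q<n = q , b≤q , q≤b+1 , q<n , halfOnEvensAndLast-even {n} even
...   | no  q≮n = b , ℕₚ.≤-refl , ℕₚ.m≤m+n b 1 , b<n , halfOnEvensAndLast-last {n} b-last
  where
  b-last : suc b ≡ n
  b-last = ℕₚ.≤-antisym b<n (ℕₚ.≤-trans (ℕₚ.≮⇒≥ q≮n) (ℕₚ.≤-trans q≤b+1 (ℕₚ.≤-reflexive (ℕₚ.+-comm b 1))))

halfOnEvensAndLast-separates : ∀ n a b → a ℕ.< b → b ℕ.< n →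
  1ℚ ≤ ∑ n (λ i → halfOnEvensAndLastℕ n i * fromℕ (χR₁ a b i))
halfOnEvensAndLast-separates n a b a<b b<n with even-below a | marked-above b<n
... | p , p≤a , a≤p+1 , even-p | q , b≤q , q≤b+1 , q<n , marked-q =
  subst (_≤ ∑ n f) (cong₂ _+_ (half p (halfOnEvensAndLast-even {n} even-p) (χR₁-left-neighbour p≤a a≤p+1 a<b))
                              (half q marked-q (χR₁-right-neighbour b≤q q≤b+1 a<b)))
    (∑-≥-two-terms n p q f≥0 p<q q<n)
  where
  f : ℕ → ℚ
  f i = halfOnEvensAndLastℕ n i * fromℕ (χR₁ a b i)
  f≥0 : ∀ i → 0ℚ ≤ f i
  f≥0 i = *-nonNeg (proj₁ (halfOnEvensAndLast-∈[0,1] n i)) (fromℕ-nonNeg (χR₁ a b i))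
  half : ∀ i → halfOnEvensAndLastℕ n i ≡ ½ → χR₁ a b i ≡ 1 → f i ≡ ½
  half i marked resolves = cong₂ (λ w k → w * fromℕ k) marked resolves
  p<q : p ℕ.< q
  p<q = ℕₚ.≤-<-trans p≤a (ℕₚ.<-≤-trans a<b b≤q)

halfOnEvensAndLast-resolving : ∀ n → IsResolving n (halfOnEvensAndLast n)
halfOnEvensAndLast-resolving n = (λ z → halfOnEvensAndLast-∈[0,1] n (toℕ z)) , resolves
  where
  resolves : ∀ x y → x ≢ y → 1ℚ ≤ hR₁ (halfOnEvensAndLast n) x y
  resolves x y x≢y with ℕₚ.<-cmp (toℕ x) (toℕ y)
  ... | tri< x<y _ _ = subst (1ℚ ≤_) (sym (hR₁≡∑ _ (halfOnEvensAndLastℕ n) (λ _ → refl) x y))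
                         (halfOnEvensAndLast-separates n _ _ x<y (Finₚ.toℕ<n y))
  ... | tri≈ _ x≡y _ = contradiction (Finₚ.toℕ-injective x≡y) x≢y
  ... | tri> _ _ y<x = subst (1ℚ ≤_) (sym (hR₁≡∑ _ (halfOnEvensAndLastℕ n) (λ _ → refl) x y))
                         (subst (1ℚ ≤_) (∑-cong n (λ i _ → cong (λ k → halfOnEvensAndLastℕ n i * fromℕ k)
                                                                (χR₁-comm (toℕ y) (toℕ x) i)))
                           (halfOnEvensAndLast-separates n _ _ y<x (Finₚ.toℕ<n x)))

∑-evenHalf : ∀ m → ∑ m evenHalf ≡ ½ * fromℕ ⌈ m /2⌉
∑-evenHalf zero          = refl
∑-evenHalf (suc zero)    = refl
∑-evenHalf (suc (suc m)) = begin
  ½ + (0ℚ + ∑ m evenHalf)          ≡⟨ cong (½ +_) (ℚₚ.+-identityˡ (∑ m evenHalf)) ⟩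
  ½ + ∑ m evenHalf                 ≡⟨ cong (½ +_) (∑-evenHalf m) ⟩
  ½ + ½ * fromℕ ⌈ m /2⌉            ≡⟨ ℚₚ.*-distribˡ-+ ½ 1ℚ (fromℕ ⌈ m /2⌉) ⟨
  ½ * (1ℚ + fromℕ ⌈ m /2⌉)         ∎
  where open ≡-Reasoning

total-halfOnEvensAndLast : ∀ m → total (halfOnEvensAndLast (suc m)) ≡ ½ * fromℕ (suc ⌈ m /2⌉)
total-halfOnEvensAndLast m = begin
  total (halfOnEvensAndLast (suc m))
    ≡⟨ Σℚ≡∑ (suc m) _ (halfOnEvensAndLastℕ (suc m)) (λ _ → refl) ⟩
  ∑ (suc m) (halfOnEvensAndLastℕ (suc m))
    ≡⟨ ∑-snoc m _ ⟩
  ∑ m (halfOnEvensAndLastℕ (suc m)) + halfOnEvensAndLastℕ (suc m) m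
    ≡⟨ cong₂ _+_ (∑-cong m (λ i i<m → halfOnEvensAndLast-inner {suc m} (ℕₚ.<⇒≢ (s≤s i<m))))
                 (halfOnEvensAndLast-last {suc m} {m} refl) ⟩
  ∑ m evenHalf + ½
    ≡⟨ cong (_+ ½) (∑-evenHalf m) ⟩
  ½ * fromℕ ⌈ m /2⌉ + ½
    ≡⟨ ℚₚ.+-comm (½ * fromℕ ⌈ m /2⌉) ½ ⟩
  ½ + ½ * fromℕ ⌈ m /2⌉
    ≡⟨ ℚₚ.*-distribˡ-+ ½ 1ℚ (fromℕ ⌈ m /2⌉) ⟨
  ½ * (1ℚ + fromℕ ⌈ m /2⌉)
    ∎
  where open ≡-Reasoning

attained-by-halfOnEvensAndLast : ∀ m {v} → ½ * fromℕ (suc ⌈ m /2⌉) ≡ v →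
  Σ (Weight (suc m)) (λ h → IsResolving (suc m) h × total h ≡ v)
attained-by-halfOnEvensAndLast m eq =
  halfOnEvensAndLast (suc m) , halfOnEvensAndLast-resolving (suc m) , trans (total-halfOnEvensAndLast m) eq

dim-3+4k : ∀ k → DimIs (3 ℕ.+ k ℕ.* 4) (½ * fromℕ (2 ℕ.+ k ℕ.* 2))
dim-3+4k k =
    attained-by-halfOnEvensAndLast (2 ℕ.+ k ℕ.* 4)
      (cong (λ t → ½ * fromℕ (2 ℕ.+ t)) (⌊r+4k/2⌋≡2k 1 k (s≤s (s≤s z≤n))))
  , λ h r → let open LowerBound h r in
      subst (_≤ total h) (sym (½*[c+2k]≡½*c+k 2 k))
        (tiling 3 k 0 (sym (ℕₚ.+-identityʳ _)) (initial-3-≥1 (ℕₚ.m≤m+n 3 _)) ℚₚ.≤-refl)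

dim-6+4k : ∀ k → DimIs (6 ℕ.+ k ℕ.* 4) (½ * fromℕ (4 ℕ.+ k ℕ.* 2))
dim-6+4k k =
    attained-by-halfOnEvensAndLast (5 ℕ.+ k ℕ.* 4)
      (cong (λ t → ½ * fromℕ (4 ℕ.+ t)) (⌊r+4k/2⌋≡2k 0 k (s≤s z≤n)))
  , λ h r → let open LowerBound h r in
      subst (_≤ total h) (sym (½*[c+2k]≡½*c+k 4 k))
        (tiling 3 k 3 (sym 3+4k+3≡6+4k) (initial-3-≥1 (ℕₚ.m≤m+n 3 _)) (final-3-≥1 (3 ℕ.+ k ℕ.* 4) 3+4k+3≡6+4k))
  where
  3+4k+3≡6+4k : 3 ℕ.+ k ℕ.* 4 ℕ.+ 3 ≡ 6 ℕ.+ k ℕ.* 4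
  3+4k+3≡6+4k = ℕₚ.+-comm (3 ℕ.+ k ℕ.* 4) 3

dim-9+4k : ∀ k → DimIs (9 ℕ.+ k ℕ.* 4) (½ * fromℕ (5 ℕ.+ k ℕ.* 2))
dim-9+4k k =
    attained-by-halfOnEvensAndLast (8 ℕ.+ k ℕ.* 4)
      (cong (λ t → ½ * fromℕ (5 ℕ.+ t)) (⌊r+4k/2⌋≡2k 1 k (s≤s (s≤s z≤n))))
  , λ h r → let open LowerBound h r in
      subst (_≤ total h) (sym (½*[c+2k]≡½*c+k 5 k))
        (tiling 6 k 3 (sym 6+4k+3≡9+4k) (initial-6-≥3/2 (ℕₚ.m≤m+n 6 _)) (final-3-≥1 (6 ℕ.+ k ℕ.* 4) 6+4k+3≡9+4k))
  where
  6+4k+3≡9+4k : 6 ℕ.+ k ℕ.* 4 ℕ.+ 3 ≡ 9 ℕ.+ k ℕ.* 4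
  6+4k+3≡9+4k = ℕₚ.+-comm (6 ℕ.+ k ℕ.* 4) 3

-- Each vertex of P₄ lies in exactly three of R₁{0,1}, R₁{2,3}, R₁{0,2}, R₁{1,3}.
dim-4 : DimIs 4 (ℤ.+ 4 ℚ./ 3)
dim-4 = (constant-third , from-yes (isResolving? 4 constant-third) , refl)
      , λ h r → a≤q*d⇒a/d≤q {4} {2} (LowerBound.double-counting-whole-path h r pairs 3)
  where
  constant-third : Weight 4
  constant-third _ = ℤ.+ 1 ℚ./ 3
  pairs : List (ℕ × ℕ)
  pairs = (0 , 1) ∷ (2 , 3) ∷ (0 , 2) ∷ (1 , 3) ∷ []

dim-5 : DimIs 5 (ℤ.+ 3 ℚ./ 2)
dim-5 = attained-by-halfOnEvensAndLast 4 refl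
      , λ h r → a≤q*d⇒a/d≤q {3} {1} (LowerBound.double-counting-whole-path h r pairs-0-2-4 2)

part-a : (n : ℕ) → 2 ℕ.≤ n → (n ≡ 2 ⊎ n ≡ 3) → DimIs n 1ℚ
part-a .2 2≤n (inj₁ refl) = attained-by-halfOnEvensAndLast 1 refl , λ h r → LowerBound.total-≥1 h r 2≤n
part-a .3 2≤n (inj₂ refl) = attained-by-halfOnEvensAndLast 2 refl , λ h r → LowerBound.total-≥1 h r 2≤n

part-b-1 : (n : ℕ) → 6 ℕ.≤ n → n % 4 ≡ 1 → DimIs n (ℤ.+ (n ℕ.+ 1) ℚ./ 4)
part-b-1 n 6≤n n%4≡1 with n / 4 | mod-4-view {n} n%4≡1
... | 0           | refl = contradiction 6≤n (from-no (6 ℕₚ.≤? 1))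
... | 1           | refl = contradiction 6≤n (from-no (6 ℕₚ.≤? 5))
... | suc (suc k) | refl =
  subst (DimIs _) (sym (2a≡bd⇒a/d≡½b {9 ℕ.+ k ℕ.* 4 ℕ.+ 1} {3} (5 ℕ.+ k ℕ.* 2) arith)) (dim-9+4k k)
  where
  open ℕ-Solver
  arith : (9 ℕ.+ k ℕ.* 4 ℕ.+ 1) ℕ.* 2 ≡ (5 ℕ.+ k ℕ.* 2) ℕ.* 4
  arith = solve 1 (λ k → (con 9 :+ k :* con 4 :+ con 1) :* con 2 := (con 5 :+ k :* con 2) :* con 4) refl k

part-b-2-3 : (n : ℕ) → 6 ℕ.≤ n → (n % 4 ≡ 2 ⊎ n % 4 ≡ 3) → DimIs n (ℤ.+ ⌈ n /4⌉ ℚ./ 1)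
part-b-2-3 n 6≤n (inj₁ n%4≡2) with n / 4 | mod-4-view {n} n%4≡2
... | 0     | refl = contradiction 6≤n (from-no (6 ℕₚ.≤? 2))
... | suc k | refl =
  subst (DimIs _) (sym (2a≡bd⇒a/d≡½b {⌈ 6 ℕ.+ k ℕ.* 4 /4⌉} {0} (4 ℕ.+ k ℕ.* 2) ceiling)) (dim-6+4k k)
  where
  open ℕ-Solver
  ceiling : ⌈ 6 ℕ.+ k ℕ.* 4 /4⌉ ℕ.* 2 ≡ (4 ℕ.+ k ℕ.* 2) ℕ.* 1
  ceiling = trans
    (cong (λ t → t / 4 ℕ.* 2)
      (solve 1 (λ k → con 6 :+ k :* con 4 :+ con 3 := (con 2 :+ k) :* con 4 :+ con 1) refl k))
    (trans (cong (ℕ._* 2) ([4m+r]/4≡m (2 ℕ.+ k) 1 (s≤s (s≤s z≤n)))) (sym (ℕₚ.*-identityʳ _)))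
part-b-2-3 n 6≤n (inj₂ n%4≡3) with n / 4 | mod-4-view {n} n%4≡3
... | k | refl =
  subst (DimIs _) (sym (2a≡bd⇒a/d≡½b {⌈ 3 ℕ.+ k ℕ.* 4 /4⌉} {0} (2 ℕ.+ k ℕ.* 2) ceiling)) (dim-3+4k k)
  where
  open ℕ-Solver
  ceiling : ⌈ 3 ℕ.+ k ℕ.* 4 /4⌉ ℕ.* 2 ≡ (2 ℕ.+ k ℕ.* 2) ℕ.* 1
  ceiling = trans
    (cong (λ t → t / 4 ℕ.* 2)
      (solve 1 (λ k → con 3 :+ k :* con 4 :+ con 3 := (con 1 :+ k) :* con 4 :+ con 2) refl k))
    (trans (cong (ℕ._* 2) ([4m+r]/4≡m (1 ℕ.+ k) 2 (s≤s (s≤s (s≤s z≤n))))) (sym (ℕₚ.*-identityʳ _)))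

part-c-8+4k : ∀ k → let n = 8 ℕ.+ k ℕ.* 4 in
  ((h : Weight n) → IsResolving n h → (ℤ.+ n ℚ./ 4) ≤ total h) ×
  Σ (Weight n) (λ h → IsResolving n h × total h ≤ (ℤ.+ (n ℕ.+ 2) ℚ./ 4))
part-c-8+4k k =
    (λ h r → let open LowerBound h r in
       subst (_≤ total h) lower-value (tiling 0 (2 ℕ.+ k) 0 (sym (ℕₚ.+-identityʳ _)) ℚₚ.≤-refl ℚₚ.≤-refl))
  , map₂ (map₂ ℚₚ.≤-reflexive) (attained-by-halfOnEvensAndLast (7 ℕ.+ k ℕ.* 4) upper-value)
  where
  open ℕ-Solver
  lower-value : 0ℚ + 0ℚ + fromℕ (2 ℕ.+ k) ≡ ℤ.+ (8 ℕ.+ k ℕ.* 4) ℚ./ 4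
  lower-value = trans (ℚₚ.+-identityˡ (fromℕ (2 ℕ.+ k))) (sym (trans
    (2a≡bd⇒a/d≡½b {8 ℕ.+ k ℕ.* 4} {3} ((2 ℕ.+ k) ℕ.* 2)
      (solve 1 (λ k → (con 8 :+ k :* con 4) :* con 2 := (con 2 :+ k) :* con 2 :* con 4) refl k))
    (½*[2a]≡a (2 ℕ.+ k))))
  upper-value : ½ * fromℕ (suc ⌈ 7 ℕ.+ k ℕ.* 4 /2⌉) ≡ ℤ.+ (8 ℕ.+ k ℕ.* 4 ℕ.+ 2) ℚ./ 4
  upper-value = trans (cong (λ t → ½ * fromℕ (5 ℕ.+ t)) (⌊r+4k/2⌋≡2k 0 k (s≤s z≤n)))
    (sym (2a≡bd⇒a/d≡½b {8 ℕ.+ k ℕ.* 4 ℕ.+ 2} {3} (5 ℕ.+ k ℕ.* 2)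
      (solve 1 (λ k → (con 8 :+ k :* con 4 :+ con 2) :* con 2 := (con 5 :+ k :* con 2) :* con 4) refl k)))

part-c : (n : ℕ) → 8 ℕ.≤ n → n % 4 ≡ 0 →
  ((h : Weight n) → IsResolving n h → (ℤ.+ n ℚ./ 4) ≤ total h) ×
  Σ (Weight n) (λ h → IsResolving n h × total h ≤ (ℤ.+ (n ℕ.+ 2) ℚ./ 4))
part-c n 8≤n n%4≡0 with n / 4 | mod-4-view {n} n%4≡0
... | 0           | refl = contradiction 8≤n (from-no (8 ℕₚ.≤? 0))
... | 1           | refl = contradiction 8≤n (from-no (8 ℕₚ.≤? 4))
... | suc (suc k) | refl = part-c-8+4k k

corollary3p12 :
    -- (a)
    ((n : ℕ) → 2 ℕ.≤ n → (n ≡ 2 ⊎ n ≡ 3) → DimIs n 1ℚ) ×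
    DimIs 4 (ℤ.+ (8 ℕ.∸ 4) ℚ./ (7 ℕ.∸ 4)) ×
    DimIs 5 (ℤ.+ (8 ℕ.∸ 5) ℚ./ (7 ℕ.∸ 5)) ×
    -- (b)
    ((n : ℕ) → 6 ℕ.≤ n → n % 4 ≡ 1 → DimIs n (ℤ.+ (n ℕ.+ 1) ℚ./ 4)) ×
    ((n : ℕ) → 6 ℕ.≤ n → (n % 4 ≡ 2 ⊎ n % 4 ≡ 3) → DimIs n (ℤ.+ ⌈ n /4⌉ ℚ./ 1)) ×
    -- (c)
    ((n : ℕ) → 8 ℕ.≤ n → n % 4 ≡ 0 →
      ((h : Weight n) → IsResolving n h → (ℤ.+ n ℚ./ 4) ≤ total h) ×
      Σ (Weight n) (λ h → IsResolving n h × total h ≤ (ℤ.+ (n ℕ.+ 2) ℚ./ 4)))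
corollary3p12 = part-a , dim-4 , dim-5 , part-b-1 , part-b-2-3 , part-c
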